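{- For positive integers $a,b$, $\operatorname{minrank}(\mathsf{P}_{a,b})=b$.
   Context: $\mathsf{P}_{a,b}=\sum_{i\in[a]}\sum_{j\in[b]}e_i\otimes e_j\otimes e_{i+j-1}\in\mathbb{C}^a\otimes\mathbb{C}^b\otimes\mathbb{C}^{a+b-1}$ is the structure tensor of multiplying a univariate polynomial of degree $a-1$ by one of degree $b-1$. For a nonzero $T\in\mathbb{C}^a\otimes\mathbb{C}^b\otimes\mathbb{C}^c$, $\operatorname{minrank}(T)=\min\bigl(\{\operatorname{rank}((\beta\otimes I_b\otimes I_c)T):\beta\in\mathbb{C}^{1\times a}\}\setminus\{0\}\bigr)$, viewing $(\beta\otimes I_b\otimes I_c)T$ as a $b\times c$ matrix. -}

module Defs where

open import Level using (Level; _⊔_) renaming (suc to lsuc)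
open import Algebra.Bundles using (CommutativeRing)
open import Data.Nat as ℕ using (ℕ; zero; suc; _∸_; _≤_)
open import Data.Fin using (Fin; toℕ) renaming (zero to fzero; suc to fsuc)
open import Data.Product using (Σ; ∃; _×_)
open import Relation.Nullary using (¬_; yes; no)
open import Relation.Binary.PropositionalEquality using (_≡_)

record Field (c ℓ : Level) : Set (lsuc (c ⊔ ℓ)) where
  field
    commutativeRing : CommutativeRing c ℓ
  open CommutativeRing commutativeRing public
  field
    0≉1 : ¬ (0# ≈ 1#)
    inverse : ∀ x → ¬ (x ≈ 0#) → Σ Carrier (λ y → x * y ≈ 1#)

module _ {c ℓ : Level} (F : Field c ℓ) where
  open Field F

  ∑ : (n : ℕ) → (Fin n → Carrier) → Carrier
  ∑ zero    f = 0#
  ∑ (suc n) f = f fzero + ∑ n (λ i → f (fsuc i))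

  -- tensors in F^a ⊗ F^b ⊗ F^c, as coefficient arrays (0-indexed)
  Tensor : ℕ → ℕ → ℕ → Set c
  Tensor a b c' = Fin a → Fin b → Fin c' → Carrier

  Matrix : ℕ → ℕ → Set c
  Matrix m n = Fin m → Fin n → Carrier

  -- P_{a,b} = Σ_{i,j} e_i ⊗ e_j ⊗ e_{i+j-1}  (1-indexed); 0-indexed: e_i ⊗ e_j ⊗ e_{i+j}
  P : (a b : ℕ) → Tensor a b (a ℕ.+ b ∸ 1)
  P a b i j k with (toℕ i ℕ.+ toℕ j) ℕ.≟ toℕ k
  ... | yes _ = 1#
  ... | no  _ = 0#

  -- (β ⊗ I_b ⊗ I_c) T, viewed as a b × c matrix
  contract : ∀ {a b c'} → (Fin a → Carrier) → Tensor a b c' → Matrix b c'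
  contract {a} β T j k = ∑ a (λ i → β i * T i j k)

  LinIndep : ∀ {r n} → (Fin r → Fin n → Carrier) → Set (c ⊔ ℓ)
  LinIndep {r} {n} v =
    ∀ (λ′ : Fin r → Carrier) →
      (∀ k → ∑ r (λ t → λ′ t * v t k) ≈ 0#) → ∀ t → λ′ t ≈ 0#

  IsRank : ∀ {m n} → Matrix m n → ℕ → Set (c ⊔ ℓ)
  IsRank {m} M r =
    (Σ (Fin r → Fin m) (λ ρ → LinIndep (λ t → M (ρ t)))) ×
    (∀ s (ρ : Fin s → Fin m) → LinIndep (λ t → M (ρ t)) → s ≤ r)

  IsMinRank : ∀ {a b c'} → Tensor a b c' → ℕ → Set (c ⊔ ℓ)
  IsMinRank {a} T m =
    (¬ (m ≡ 0)) ×
    (Σ (Fin a → Carrier) (λ β → IsRank (contract β T) m)) ×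
    (∀ (β : Fin a → Carrier) r → IsRank (contract β T) r → ¬ (r ≡ 0) → m ≤ r)

-- Row j of (β ⊗ I ⊗ I) P_{a,b} is the coefficient vector of x^j β(x), so a
-- relation among the rows is a polynomial λ with λ β = 0.  Whenever the
-- contraction has nonzero rank no nonzero scalar annihilates β, and then
-- (McCoy) λ β = 0 forces λ = 0: all b rows are independent.  Conversely a
-- b-row matrix never has more than b independent rows, and β = (1,0,…,0)
-- attains b.
module Submission where

open import Defs
open import Level using (_⊔_)
open import Algebra.Bundles using (CommutativeRing)
open import Data.Bool using (if_then_else_)
open import Data.Nat as ℕ using (ℕ; zero; suc; _≤_; _<_; _∸_; _≡ᵇ_)
import Data.Nat.Properties as ℕ
open import Data.Nat.Induction using (<-rec)
open import Data.Fin as Fin using (Fin; toℕ; fromℕ<)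
import Data.Fin.Properties as Fin
open import Data.Vec.Functional using (Vector; _∷_; replicate)
open import Function using (id; _∘_)
open import Data.Product using (∃-syntax; _×_; _,_; proj₂)
open import Data.Sum using (_⊎_; inj₁; inj₂)
open import Relation.Nullary using (yes; no; contradiction)
open import Relation.Binary.PropositionalEquality as ≡ using (_≡_; _≢_)
import Relation.Binary.Reasoning.Setoid as SetoidReasoning

module Polynomials {c ℓ} (R : CommutativeRing c ℓ) where

  open CommutativeRing R hiding (zero)
  open import Algebra.Properties.Semiring.Sum semiring
    using (sum; sum-cong-≋; sum-replicate-zero; *-distribˡ-sum)
  open SetoidReasoning setoid

  sum-zero : ∀ {n} {f : Vector Carrier n} → (∀ i → f i ≈ 0#) → sum f ≈ 0#
  sum-zero {n} f≈0 = trans (sum-cong-≋ f≈0) (sum-replicate-zero n)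

  𝟙[_≡_] : ℕ → ℕ → Carrier
  𝟙[ m ≡ n ] = if m ≡ᵇ n then 1# else 0#

  𝟙-≡ : ∀ {m n} → m ≡ n → 𝟙[ m ≡ n ] ≡ 1#
  𝟙-≡ {zero}  ≡.refl = ≡.refl
  𝟙-≡ {suc m} ≡.refl = 𝟙-≡ {m} ≡.refl

  𝟙-≢ : ∀ {m n} → m ≢ n → 𝟙[ m ≡ n ] ≡ 0#
  𝟙-≢ {zero}  {zero}  m≢n = contradiction ≡.refl m≢n
  𝟙-≢ {zero}  {suc n} m≢n = ≡.refl
  𝟙-≢ {suc m} {zero}  m≢n = ≡.refl
  𝟙-≢ {suc m} {suc n} m≢n = 𝟙-≢ (m≢n ∘ ≡.cong suc)

  extend : ∀ {a} → Vector Carrier a → ℕ → Carrier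
  extend {zero}  β m       = 0#
  extend {suc a} β zero    = β Fin.zero
  extend {suc a} β (suc m) = extend (λ i → β (Fin.suc i)) m

  extend-toℕ : ∀ {a} (β : Vector Carrier a) i → extend β (toℕ i) ≡ β i
  extend-toℕ β Fin.zero    = ≡.refl
  extend-toℕ β (Fin.suc i) = extend-toℕ (λ i → β (Fin.suc i)) i

  extend-beyond : ∀ {a} (β : Vector Carrier a) {m} → a ≤ m → extend β m ≡ 0#
  extend-beyond {zero}  β         a≤m         = ≡.refl
  extend-beyond {suc a} β {suc m} (ℕ.s≤s a≤m) = extend-beyond (λ i → β (Fin.suc i)) a≤m

  sum-*𝟙 : ∀ {a} (β : Vector Carrier a) m → sum (λ i → β i * 𝟙[ toℕ i ≡ m ]) ≈ extend β m
  sum-*𝟙 {zero}  β m       = refl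
  sum-*𝟙 {suc a} β zero    = begin
    β Fin.zero * 1# + sum (λ i → β (Fin.suc i) * 0#)
      ≈⟨ +-cong (*-identityʳ _) (sum-zero (λ i → zeroʳ (β (Fin.suc i)))) ⟩
    β Fin.zero + 0#
      ≈⟨ +-identityʳ _ ⟩
    β Fin.zero ∎
  sum-*𝟙 {suc a} β (suc m) = begin
    β Fin.zero * 0# + sum (λ i → β (Fin.suc i) * 𝟙[ toℕ i ≡ m ])
      ≈⟨ +-cong (zeroʳ _) (sum-*𝟙 (λ i → β (Fin.suc i)) m) ⟩
    0# + extend (λ i → β (Fin.suc i)) m
      ≈⟨ +-identityˡ _ ⟩
    extend (λ i → β (Fin.suc i)) m ∎

  -- shift t f is the coefficient sequence of x^t f(x)
  shift : ℕ → (ℕ → Carrier) → ℕ → Carrier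
  shift zero    f k       = f k
  shift (suc t) f zero    = 0#
  shift (suc t) f (suc k) = shift t f k

  shift-cases : ∀ t f k → shift t f k ≡ 0# ⊎ ∃[ j ] j ℕ.+ t ≡ k × shift t f k ≡ f j
  shift-cases zero    f k       = inj₂ (k , ℕ.+-identityʳ k , ≡.refl)
  shift-cases (suc t) f zero    = inj₁ ≡.refl
  shift-cases (suc t) f (suc k) with shift-cases t f k
  ... | inj₁ z               = inj₁ z
  ... | inj₂ (j , j+t≡k , e) = inj₂ (j , ≡.trans (ℕ.+-suc j t) (≡.cong suc j+t≡k) , e)

  shift-beyond : ∀ {a} (β : Vector Carrier a) t {k} → a ℕ.+ t ≤ k → shift t (extend β) k ≡ 0#
  shift-beyond {a} β t {k} a+t≤k with shift-cases t (extend β) k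
  ... | inj₁ z               = z
  ... | inj₂ (j , j+t≡k , e) = ≡.trans e (extend-beyond β a≤j)
    where
    a≤j : a ≤ j
    a≤j = ℕ.+-cancelʳ-≤ t a j (≡.subst (a ℕ.+ t ≤_) (≡.sym j+t≡k) a+t≤k)

  annihilates-shift : ∀ {μ f} → (∀ i → μ * f i ≈ 0#) → ∀ t k → μ * shift t f k ≈ 0#
  annihilates-shift {μ} {f} μf≈0 t k with shift-cases t f k
  ... | inj₁ z           = trans (*-congˡ (reflexive z)) (zeroʳ μ)
  ... | inj₂ (j , _ , e) = trans (*-congˡ (reflexive e)) (μf≈0 j)

  sum-*𝟙-shift : ∀ {a} (β : Vector Carrier a) t k →
                 sum (λ i → β i * 𝟙[ t ℕ.+ toℕ i ≡ k ]) ≈ shift t (extend β) k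
  sum-*𝟙-shift β zero    k       = sum-*𝟙 β k
  sum-*𝟙-shift β (suc t) zero    = sum-zero (λ i → zeroʳ (β i))
  sum-*𝟙-shift β (suc t) (suc k) = sum-*𝟙-shift β t k

  infixl 7 _⊛_
  _⊛_ : ∀ {n} → Vector Carrier n → (ℕ → Carrier) → ℕ → Carrier
  (g ⊛ f) k = sum (λ t → g t * shift (toℕ t) f k)

  ScalarFaithful : (ℕ → Carrier) → Set (c ⊔ ℓ)
  ScalarFaithful f = ∀ μ → (∀ i → μ * f i ≈ 0#) → μ ≈ 0#

  ⊛-cancelʳ : ∀ {f} → ScalarFaithful f → ∀ {n} (g : Vector Carrier n) →
              (∀ k → (g ⊛ f) k ≈ 0#) → ∀ t → g t ≈ 0#
  ⊛-cancelʳ {f} faithful {suc n} g g⊛f≈0 t =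
    faithful (g t) (λ i → trans (*-comm _ _) (<-rec _ annihilates i t))
    where
    g′ : Vector Carrier n
    g′ t = g (Fin.suc t)

    -- coefficient i of g f is g₀ fᵢ plus terms gₜ fⱼ with j < i
    head-annihilated : ∀ i → (∀ {j} → j < i → ∀ t → f j * g t ≈ 0#) → f i * g Fin.zero ≈ 0#
    head-annihilated i ih = begin
      f i * g Fin.zero                                               ≈⟨ *-comm _ _ ⟩
      g Fin.zero * f i                                               ≈⟨ +-identityʳ _ ⟨
      g Fin.zero * f i + 0#                                          ≈⟨ +-congˡ (sum-zero later-term≈0) ⟨
      g Fin.zero * f i + sum (λ t → g′ t * shift (suc (toℕ t)) f i) ≈⟨ g⊛f≈0 i ⟩
      0#                                                             ∎
      where
      later-term≈0 : ∀ t → g′ t * shift (suc (toℕ t)) f i ≈ 0#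
      later-term≈0 t with shift-cases (suc (toℕ t)) f i
      ... | inj₁ z               = trans (*-congˡ (reflexive z)) (zeroʳ _)
      ... | inj₂ (j , j+t≡i , e) =
        trans (*-congˡ (reflexive e)) (trans (*-comm _ _) (ih j<i (Fin.suc t)))
        where
        j<i : j < i
        j<i = ≡.subst (j <_) j+t≡i (ℕ.m<m+n j ℕ.z<s)

    tail-annihilated : ∀ i → f i * g Fin.zero ≈ 0# → ∀ k → ((λ t → f i * g′ t) ⊛ f) k ≈ 0#
    tail-annihilated i fᵢg₀≈0 k = begin
      sum (λ t → f i * g′ t * shift (toℕ t) f k)
        ≈⟨ sum-cong-≋ (λ t → *-assoc (f i) (g′ t) (shift (toℕ t) f k)) ⟩
      sum (λ t → f i * (g′ t * shift (toℕ t) f k))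
        ≈⟨ *-distribˡ-sum (f i) (λ t → g′ t * shift (toℕ t) f k) ⟨
      f i * (g′ ⊛ f) k                                    ≈⟨ +-identityˡ _ ⟨
      0# + f i * (g′ ⊛ f) k                               ≈⟨ +-congʳ fᵢg₀fₖ≈0 ⟨
      f i * (g Fin.zero * f (suc k)) + f i * (g′ ⊛ f) k   ≈⟨ distribˡ _ _ _ ⟨
      f i * (g ⊛ f) (suc k)                               ≈⟨ *-congˡ (g⊛f≈0 (suc k)) ⟩
      f i * 0#                                            ≈⟨ zeroʳ _ ⟩
      0#                                                  ∎
      where
      fᵢg₀fₖ≈0 : f i * (g Fin.zero * f (suc k)) ≈ 0#
      fᵢg₀fₖ≈0 = trans (sym (*-assoc _ _ _)) (trans (*-congʳ fᵢg₀≈0) (zeroˡ _))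

    annihilates : ∀ i → (∀ {j} → j < i → ∀ t → f j * g t ≈ 0#) → ∀ t → f i * g t ≈ 0#
    annihilates i ih Fin.zero    = head-annihilated i ih
    annihilates i ih (Fin.suc t) =
      ⊛-cancelʳ faithful (λ t → f i * g′ t) (tail-annihilated i (head-annihilated i ih)) t

module Contraction {c ℓ} (F : Field c ℓ) where

  open Field F hiding (zero)
  open Polynomials commutativeRing
  open import Algebra.Properties.Semiring.Sum semiring using (sum; sum-cong-≋; ∑-distrib-+)
  open import Algebra.Properties.Ring ring using (-‿distribˡ-*; [y-z]x≈yx-zx; -0#≈0#)
  open SetoidReasoning setoid

  ∑≡sum : ∀ n (f : Vector Carrier n) → ∑ F n f ≡ sum f
  ∑≡sum zero    f = ≡.refl
  ∑≡sum (suc n) f = ≡.cong (f Fin.zero +_) (∑≡sum n (λ i → f (Fin.suc i)))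

  P≡𝟙 : ∀ {a b} i j k → P F a b i j k ≡ 𝟙[ toℕ j ℕ.+ toℕ i ≡ toℕ k ]
  P≡𝟙 i j k with toℕ i ℕ.+ toℕ j ℕ.≟ toℕ k
  ... | yes i+j≡k = ≡.sym (𝟙-≡ (≡.trans (ℕ.+-comm (toℕ j) (toℕ i)) i+j≡k))
  ... | no  i+j≢k = ≡.sym (𝟙-≢ (i+j≢k ∘ ≡.trans (ℕ.+-comm (toℕ i) (toℕ j))))

  contract-P : ∀ {a b} (β : Vector Carrier a) j k →
               contract F β (P F a b) j k ≈ shift (toℕ j) (extend β) (toℕ k)
  contract-P {a} {b} β j k = begin
    ∑ F a (λ i → β i * P F a b i j k)
      ≡⟨ ∑≡sum a _ ⟩
    sum (λ i → β i * P F a b i j k)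
      ≈⟨ sum-cong-≋ (λ i → *-congˡ {β i} (reflexive (P≡𝟙 {a} {b} i j k))) ⟩
    sum (λ i → β i * 𝟙[ toℕ j ℕ.+ toℕ i ≡ toℕ k ])
      ≈⟨ sum-*𝟙-shift β (toℕ j) (toℕ k) ⟩
    shift (toℕ j) (extend β) (toℕ k) ∎

  LinIndep⇒injective : ∀ {r n} (v : Fin r → Fin n → Carrier) → LinIndep F v →
                       ∀ {t₁ t₂} → v t₁ ≡ v t₂ → t₁ ≡ t₂
  LinIndep⇒injective {r} v indep {t₁} {t₂} v₁≡v₂ with t₁ Fin.≟ t₂
  ... | yes t₁≡t₂ = t₁≡t₂
  ... | no  t₁≢t₂ = contradiction (sym 1≈0) 0≉1
    where
    δ₁ δ₂ λ′ : Vector Carrier r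
    δ₁ t = 𝟙[ toℕ t ≡ toℕ t₁ ]
    δ₂ t = 𝟙[ toℕ t ≡ toℕ t₂ ]
    λ′ t = δ₁ t - δ₂ t

    relation : ∀ k → ∑ F r (λ t → λ′ t * v t k) ≈ 0#
    relation k = begin
      ∑ F r (λ t → λ′ t * v t k)
        ≡⟨ ∑≡sum r _ ⟩
      sum (λ t → λ′ t * v t k)
        ≈⟨ sum-cong-≋ split ⟩
      sum (λ t → vₖ t * δ₁ t + - vₖ t * δ₂ t)
        ≈⟨ ∑-distrib-+ (λ t → vₖ t * δ₁ t) (λ t → - vₖ t * δ₂ t) ⟩
      sum (λ t → vₖ t * δ₁ t) + sum (λ t → - vₖ t * δ₂ t)
        ≈⟨ +-cong (sum-*𝟙 vₖ (toℕ t₁)) (sum-*𝟙 (λ t → - vₖ t) (toℕ t₂)) ⟩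
      extend vₖ (toℕ t₁) + extend (λ t → - vₖ t) (toℕ t₂)
        ≡⟨ ≡.cong₂ _+_ (extend-toℕ vₖ t₁) (extend-toℕ (λ t → - vₖ t) t₂) ⟩
      v t₁ k - v t₂ k
        ≡⟨ ≡.cong (λ w → w k - v t₂ k) v₁≡v₂ ⟩
      v t₂ k - v t₂ k
        ≈⟨ -‿inverseʳ _ ⟩
      0# ∎
      where
      vₖ : Vector Carrier r
      vₖ t = v t k

      split : ∀ t → λ′ t * vₖ t ≈ vₖ t * δ₁ t + - vₖ t * δ₂ t
      split t = trans ([y-z]x≈yx-zx (vₖ t) (δ₁ t) (δ₂ t))
                      (+-cong (*-comm _ _) (trans (-‿cong (*-comm _ _)) (-‿distribˡ-* _ _)))

    1≈0 : 1# ≈ 0#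
    1≈0 = begin
      1#        ≈⟨ +-identityʳ 1# ⟨
      1# + 0#   ≈⟨ +-congˡ -0#≈0# ⟨
      1# - 0#   ≡⟨ ≡.cong₂ _-_ (𝟙-≡ {toℕ t₁} ≡.refl) (𝟙-≢ (t₁≢t₂ ∘ Fin.toℕ-injective)) ⟨
      λ′ t₁     ≈⟨ indep λ′ relation t₁ ⟩
      0#        ∎

  independent-rows≤ : ∀ {m n s} (M : Matrix F m n) (ρ : Fin s → Fin m) → LinIndep F (M ∘ ρ) → s ≤ m
  independent-rows≤ M ρ indep = Fin.injective⇒≤ (LinIndep⇒injective (M ∘ ρ) indep ∘ ≡.cong M)

  rank≢0⇒noScalarAnnihilator : ∀ {m n r} {M : Matrix F m n} → IsRank F M r → r ≢ 0 →
                               ∀ μ → (∀ j k → μ * M j k ≈ 0#) → μ ≈ 0#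
  rank≢0⇒noScalarAnnihilator {r = zero}          _               r≢0 = contradiction ≡.refl r≢0
  rank≢0⇒noScalarAnnihilator {r = suc r} {M = M} ((ρ , indep) , _) _ μ μM≈0 =
    indep (μ ∷ replicate r 0#) relation Fin.zero
    where
    relation : ∀ k → μ * M (ρ Fin.zero) k + ∑ F r (λ t → 0# * M (ρ (Fin.suc t)) k) ≈ 0#
    relation k = begin
      μ * M (ρ Fin.zero) k + ∑ F r (λ t → 0# * M (ρ (Fin.suc t)) k)
        ≡⟨ ≡.cong (_ +_) (∑≡sum r _) ⟩
      μ * M (ρ Fin.zero) k + sum (λ t → 0# * M (ρ (Fin.suc t)) k)
        ≈⟨ +-cong (μM≈0 _ k) (sum-zero (λ t → zeroˡ (M (ρ (Fin.suc t)) k))) ⟩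
      0# + 0#
        ≈⟨ +-identityʳ 0# ⟩
      0# ∎

  contract-P-rank≢0⇒faithful : ∀ {a b r} (β : Vector Carrier a) →
                               IsRank F (contract F β (P F a b)) r → r ≢ 0 → ScalarFaithful (extend β)
  contract-P-rank≢0⇒faithful β rank r≢0 μ μβ≈0 = rank≢0⇒noScalarAnnihilator rank r≢0 μ
    (λ j k → trans (*-congˡ (contract-P β j k)) (annihilates-shift μβ≈0 (toℕ j) (toℕ k)))

  contract-P-rows-independent : ∀ {a b} (β : Vector Carrier a) → ScalarFaithful (extend β) →
                                LinIndep F (contract F β (P F a b))
  contract-P-rows-independent {a} {b} β faithful λ′ relation = ⊛-cancelʳ faithful λ′ λ′⊛β≈0
    where
    λ′⊛β≈0 : ∀ k → (λ′ ⊛ extend β) k ≈ 0#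
    λ′⊛β≈0 k with k ℕ.<? a ℕ.+ b ∸ 1
    ... | yes k<c = begin
      (λ′ ⊛ extend β) k
        ≡⟨ ≡.cong (λ′ ⊛ extend β) (Fin.toℕ-fromℕ< k<c) ⟨
      (λ′ ⊛ extend β) (toℕ k′)
        ≈⟨ sum-cong-≋ (λ t → *-congˡ (sym (contract-P β t k′))) ⟩
      sum (λ t → λ′ t * contract F β (P F a b) t k′)
        ≡⟨ ∑≡sum b _ ⟨
      ∑ F b (λ t → λ′ t * contract F β (P F a b) t k′)
        ≈⟨ relation k′ ⟩
      0# ∎
      where
      k′ : Fin (a ℕ.+ b ∸ 1)
      k′ = fromℕ< k<c
    ... | no  k≮c =
      sum-zero (λ t → trans (*-congˡ (reflexive (shift-beyond β (toℕ t) (a+t≤k t)))) (zeroʳ _))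
      where
      a+t≤k : ∀ t → a ℕ.+ toℕ t ≤ k
      a+t≤k t = ℕ.≤-trans (ℕ.<⇒≤pred (ℕ.+-monoʳ-< a (Fin.toℕ<n t)))
                          (≡.subst (_≤ k) (ℕ.pred[m∸n]≡m∸[1+n] (a ℕ.+ b) 0) (ℕ.≮⇒≥ k≮c))

lemma3p10 : ∀ {c ℓ} (F : Field c ℓ) (a b : ℕ) → 1 ≤ a → 1 ≤ b → IsMinRank F (P F a b) b
lemma3p10 F (suc a) (suc b) _ _ = (λ ()) , (e₀ , rank-e₀) , minimal
  where
  open Field F using (Carrier; 0#; 1#; trans; sym; *-identityʳ)
  open Polynomials (Field.commutativeRing F) using (extend; ScalarFaithful)
  open Contraction F

  M : Vector Carrier (suc a) → Matrix F (suc b) (suc a ℕ.+ suc b ∸ 1)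
  M β = contract F β (P F (suc a) (suc b))

  e₀ : Vector Carrier (suc a)
  e₀ = 1# ∷ replicate a 0#

  e₀-faithful : ScalarFaithful (extend e₀)
  e₀-faithful μ μe₀≈0 = trans (sym (*-identityʳ μ)) (μe₀≈0 0)

  rank-e₀ : IsRank F (M e₀) (suc b)
  rank-e₀ = (id , contract-P-rows-independent e₀ e₀-faithful) , λ _ → independent-rows≤ (M e₀)

  minimal : ∀ β r → IsRank F (M β) r → r ≢ 0 → suc b ≤ r
  minimal β r rank r≢0 =
    proj₂ rank (suc b) id (contract-P-rows-independent β (contract-P-rank≢0⇒faithful β rank r≢0))
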